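{- Let $n,k,r$ be positive integers with $r\geq 2$ and $n\geq rk$. Let $\tau:\mathbb{N}\to\{0,1,\ldots,r-1\}$ be a color-frequency mapping such that $r-1\in\tau(\mathbb{N})$. Then $$\chi_M(\tau,K_n^k)\leq \min\left(\left\{|A| : A\subset\mathbb{N},\ A\text{ finite},\ \sum_{a\in A}\tau(a)\geq n-r(k-1)\right\}\cup\{+\infty\}\right).$$
   Context: $K_n^k$ is the complete $k$-uniform hypergraph with vertex set $[n]=\{1,\ldots,n\}$ and hyperedge set all $k$-subsets of $[n]$. A matching of size $m$ is a set of $m$ pairwise disjoint hyperedges. A color-frequency mapping is any map $\tau:\mathbb{N}\to\{0,1,\ldots,r-1\}$. For $A\subseteq\mathbb{N}$, an $(A,\tau)$-matching coloring of a hypergraph $\mathcal H$ is a map $c:E(\mathcal H)\to A$ such that for every $a\in A$ there is no matching of size $\tau(a)+1$ all of whose hyperedges have color $a$. The $\tau$-matching chromatic number $\chi_M(\tau,\mathcal H)$ is the least $|A|$ over finite $A\subset\mathbb{N}$ for which $\mathcal H$ admits an $(A,\tau)$-matching coloring, and $+\infty$ if no such finite $A$ exists. -}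

module Defs where

open import Data.Nat using (ℕ; suc; _≤_)
open import Data.Fin using (Fin; toℕ)
open import Data.Fin.Subset using (Subset; ∣_∣; _∩_; Empty)
open import Data.List using (List; length)
open import Data.List.Relation.Unary.Unique.Propositional using (Unique)
open import Data.List.Membership.Propositional using (_∈_)
open import Data.Product using (Σ; ∃; _×_; proj₁)
open import Relation.Binary.PropositionalEquality using (_≡_)
open import Relation.Nullary using (¬_)

Hypergraph : ℕ → Set₁
Hypergraph n = Subset n → Set

Complete : (n k : ℕ) → Hypergraph n
Complete n k e = ∣ e ∣ ≡ k

HEdge : ∀ {n} → Hypergraph n → Set
HEdge {n} H = Σ (Subset n) H

IsMatching : ∀ {n} (H : Hypergraph n) {m : ℕ} → (Fin m → HEdge H) → Set
IsMatching H {m} M = ∀ (i j : Fin m) → ¬ i ≡ j → Empty (proj₁ (M i) ∩ proj₁ (M j))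

ColorFrequency : ℕ → Set
ColorFrequency r = ℕ → Fin r

FinSetℕ : Set
FinSetℕ = Σ (List ℕ) Unique

card : FinSetℕ → ℕ
card A = length (proj₁ A)

IsMatchingColoring : ∀ {n r} → ColorFrequency r → (H : Hypergraph n) →
                     FinSetℕ → (HEdge H → ℕ) → Set
IsMatchingColoring τ H A c =
  (∀ e → c e ∈ proj₁ A) ×
  (∀ a → a ∈ proj₁ A →
     ¬ (Σ (Fin (suc (toℕ (τ a))) → HEdge H) λ M →
          IsMatching H M × (∀ i → c (M i) ≡ a)))

-- "χ_M(τ,H) ≤ m" (m finite): some finite A ⊂ ℕ with |A| ≤ m admits an
-- (A,τ)-matching coloring of H.
χM≤ : ∀ {n r} → ColorFrequency r → Hypergraph n → ℕ → Set
χM≤ τ H m = ∃ λ (A : FinSetℕ) → card A ≤ m × ∃ λ c → IsMatchingColoring τ H A c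

-- Pick a* with τ(a*) = r - 1 and exchange one element of A for it; this keeps |A| and
-- lowers the sum by at most r - 1, leaving colours a₁, …, a_ℓ besides a* with
-- n - Σ τ(aᵢ) < rk. Colour a hyperedge by its least vertex: the first τ(a₁) vertices
-- give colour a₁, the next τ(a₂) give a₂, and so on, and all remaining vertices give a*.
-- Disjoint hyperedges have distinct least vertices, so by pigeonhole a matching of
-- colour aᵢ has at most τ(aᵢ) edges; a matching of colour a* lies on the fewer than rk
-- remaining vertices, so it has at most r - 1 edges.
module Submission where

open import Defs
open import Data.Nat using (ℕ; _≤_; _*_; _∸_)
open import Data.Fin using (toℕ)
open import Data.List using (map)
open import Data.Nat.ListAction using (sum)
open import Data.Product using (∃; proj₁)
open import Relation.Binary.PropositionalEquality using (_≡_)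

open import Data.Nat using (zero; suc; _+_; _<_; z≤n; s≤s; s≤s⁻¹; z<s; _<?_)
open import Data.Nat.Properties
open import Data.Nat.ListAction.Properties using (sum-↭)
open import Data.Nat.Tactic.RingSolver using (solve-∀)
open import Data.Fin using (Fin; fromℕ<) renaming (zero to fzero; suc to fsuc; _≤_ to _≤ᶠ_)
open import Data.Fin.Properties using (pigeonhole; toℕ-fromℕ<; toℕ-injective; toℕ<n)
  renaming (suc-injective to fsuc-injective; <⇒≢ to <ᶠ⇒≢)
open import Data.Fin.Subset
  using (Subset; inside; outside; ⊥; ⋃; ∣_∣; _∪_; _∩_; Empty; Nonempty)
  renaming (_∈_ to _∈ˢ_)
open import Data.Fin.Subset.Properties
  using (nonempty?; Empty-unique; ∣⊥∣≡0; drop-∷-Empty; ∣p∣≤n; x∈p∪q⁻; x∈p∩q⁺; x∈p∩q⁻; ∉⊥)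
open import Data.Vec.Base using ([]; _∷_; here; there)
open import Data.List using (List; tabulate; _++_) renaming ([] to []ᴸ; _∷_ to _∷ᴸ_)
open import Data.List.Membership.Propositional using (_∈_)
open import Data.List.Membership.Propositional.Properties using (∈-∃++)
open import Data.List.Membership.DecPropositional _≟_ using (_∈?_)
open import Data.List.Relation.Unary.Any using () renaming (here to hereᴸ; there to thereᴸ)
open import Data.List.Relation.Unary.All as All using ()
open import Data.List.Relation.Unary.All.Properties using (¬Any⇒All¬)
open import Data.List.Relation.Unary.AllPairs using () renaming (_∷_ to _∷ᵃ_)
open import Data.List.Relation.Unary.Unique.Propositional using (Unique)
open import Data.List.Relation.Binary.Permutation.Propositional using (_↭_; ↭-refl; ↭-trans; ↭-reflexive; ↭⇒↭ₛ)
open import Data.List.Relation.Binary.Permutation.Propositional.Properties using (shift; ↭-length)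
  renaming (map⁺ to ↭-map⁺)
open import Data.List.Relation.Binary.Permutation.Setoid.Properties as Permₛ using ()
open import Data.Product using (Σ; ∃₂; _×_; _,_; proj₂)
open import Data.Sum using (inj₁; inj₂)
open import Function using (_∘_)
open import Relation.Binary.PropositionalEquality
  using (_≢_; refl; sym; trans; cong; cong₂; subst; setoid; module ≡-Reasoning)
open import Relation.Nullary using (¬_; yes; no; contradiction)

Least : ∀ {n} → Subset n → Fin n → Set
Least p v = v ∈ˢ p × (∀ {u} → u ∈ˢ p → v ≤ᶠ u)

least : ∀ {n} (p : Subset n) → Nonempty p → ∃ (Least p)
least (inside ∷ p) _ = fzero , here , λ _ → z≤n
least (outside ∷ p) (fsuc x , there x∈p) with v , v∈p , v≤ ← least p (x , x∈p) =
  fsuc v , there v∈p , λ { (there u∈p) → s≤s (v≤ u∈p) }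

∣p∣>0⇒Nonempty : ∀ {n} (p : Subset n) → 0 < ∣ p ∣ → Nonempty p
∣p∣>0⇒Nonempty {n} p ∣p∣>0 with nonempty? p
... | yes p≢∅ = p≢∅
... | no p≡∅ = contradiction (trans (cong ∣_∣ (Empty-unique p≡∅)) (∣⊥∣≡0 n)) (>⇒≢ ∣p∣>0)

∣p∪q∣≡∣p∣+∣q∣ : ∀ {n} (p q : Subset n) → Empty (p ∩ q) → ∣ p ∪ q ∣ ≡ ∣ p ∣ + ∣ q ∣
∣p∪q∣≡∣p∣+∣q∣ [] [] _ = refl
∣p∪q∣≡∣p∣+∣q∣ (inside ∷ p) (inside ∷ q) p∩q≡∅ = contradiction (fzero , here) p∩q≡∅
∣p∪q∣≡∣p∣+∣q∣ (inside ∷ p) (outside ∷ q) p∩q≡∅ =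
  cong suc (∣p∪q∣≡∣p∣+∣q∣ p q (drop-∷-Empty p∩q≡∅))
∣p∪q∣≡∣p∣+∣q∣ (outside ∷ p) (inside ∷ q) p∩q≡∅ =
  trans (cong suc (∣p∪q∣≡∣p∣+∣q∣ p q (drop-∷-Empty p∩q≡∅))) (sym (+-suc ∣ p ∣ ∣ q ∣))
∣p∪q∣≡∣p∣+∣q∣ (outside ∷ p) (outside ∷ q) p∩q≡∅ = ∣p∪q∣≡∣p∣+∣q∣ p q (drop-∷-Empty p∩q≡∅)

∣p∣≤n∸s : ∀ {n} s (p : Subset n) → (∀ {v} → v ∈ˢ p → s ≤ toℕ v) → ∣ p ∣ ≤ n ∸ s
∣p∣≤n∸s s [] _ = z≤n
∣p∣≤n∸s zero p _ = ∣p∣≤n p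
∣p∣≤n∸s (suc s) (inside ∷ p) p≥s with () ← p≥s here
∣p∣≤n∸s (suc s) (outside ∷ p) p≥s = ∣p∣≤n∸s s p (s≤s⁻¹ ∘ p≥s ∘ there)

PairwiseDisjoint : ∀ {m n} → (Fin m → Subset n) → Set
PairwiseDisjoint f = ∀ i j → i ≢ j → Empty (f i ∩ f j)

⋃ᶠ : ∀ {m n} → (Fin m → Subset n) → Subset n
⋃ᶠ f = ⋃ (tabulate f)

∈⋃ᶠ⁻ : ∀ {m n} (f : Fin m → Subset n) {x} → x ∈ˢ ⋃ᶠ f → ∃ λ i → x ∈ˢ f i
∈⋃ᶠ⁻ {zero} f x∈⋃f = contradiction x∈⋃f ∉⊥
∈⋃ᶠ⁻ {suc m} f x∈⋃f with x∈p∪q⁻ (f fzero) (⋃ᶠ (f ∘ fsuc)) x∈⋃f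
... | inj₁ x∈f₀ = fzero , x∈f₀
... | inj₂ x∈⋃f′ with i , x∈fᵢ ← ∈⋃ᶠ⁻ (f ∘ fsuc) x∈⋃f′ = fsuc i , x∈fᵢ

∣⋃ᶠ∣≡m*k : ∀ {m n k} (f : Fin m → Subset n) → PairwiseDisjoint f →
           (∀ i → ∣ f i ∣ ≡ k) → ∣ ⋃ᶠ f ∣ ≡ m * k
∣⋃ᶠ∣≡m*k {zero} {n} f _ _ = ∣⊥∣≡0 n
∣⋃ᶠ∣≡m*k {suc m} {k = k} f disjoint size = begin
  ∣ f fzero ∪ ⋃ᶠ (f ∘ fsuc) ∣          ≡⟨ ∣p∪q∣≡∣p∣+∣q∣ (f fzero) (⋃ᶠ (f ∘ fsuc)) head-disjoint ⟩
  ∣ f fzero ∣ + ∣ ⋃ᶠ (f ∘ fsuc) ∣      ≡⟨ cong₂ _+_ (size fzero) (∣⋃ᶠ∣≡m*k (f ∘ fsuc) tail-disjoint (size ∘ fsuc)) ⟩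
  k + m * k                            ∎
  where
  open ≡-Reasoning
  tail-disjoint : PairwiseDisjoint (f ∘ fsuc)
  tail-disjoint i j i≢j = disjoint (fsuc i) (fsuc j) (i≢j ∘ fsuc-injective)
  head-disjoint : Empty (f fzero ∩ ⋃ᶠ (f ∘ fsuc))
  head-disjoint (x , x∈f₀∩⋃) with x∈f₀ , x∈⋃ ← x∈p∩q⁻ (f fzero) (⋃ᶠ (f ∘ fsuc)) x∈f₀∩⋃
                           with i , x∈fᵢ ← ∈⋃ᶠ⁻ (f ∘ fsuc) x∈⋃ =
    disjoint fzero (fsuc i) (λ ()) (x , x∈p∩q⁺ (x∈f₀ , x∈fᵢ))

module Blocks (w : ℕ → ℕ) (d : ℕ) where

  block : List ℕ → ℕ → ℕ
  block []ᴸ x = d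
  block (y ∷ᴸ ys) x with x <? w y
  ... | yes _ = y
  ... | no _ = block ys (x ∸ w y)

  block-∈ : ∀ L x → block L x ∈ d ∷ᴸ L
  block-∈ []ᴸ x = hereᴸ refl
  block-∈ (y ∷ᴸ ys) x with x <? w y
  ... | yes _ = thereᴸ (hereᴸ refl)
  ... | no _ with block-∈ ys (x ∸ w y)
  ...   | hereᴸ b≡d = hereᴸ b≡d
  ...   | thereᴸ b∈ys = thereᴸ (thereᴸ b∈ys)

  block≡d⇒sum≤ : ∀ {L} → Unique (d ∷ᴸ L) → ∀ x → block L x ≡ d → sum (map w L) ≤ x
  block≡d⇒sum≤ {[]ᴸ} _ _ _ = z≤n
  block≡d⇒sum≤ {y ∷ᴸ ys} ((d≢y All.∷ d∉ys) ∷ᵃ (_ ∷ᵃ ys-unique)) x b≡d with x <? w y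
  ... | yes _ = contradiction (sym b≡d) d≢y
  ... | no x≮wy = begin
    w y + sum (map w ys)  ≤⟨ +-monoʳ-≤ (w y) (block≡d⇒sum≤ (d∉ys ∷ᵃ ys-unique) (x ∸ w y) b≡d) ⟩
    w y + (x ∸ w y)       ≡⟨ m+[n∸m]≡n (≮⇒≥ x≮wy) ⟩
    x                     ∎
    where open ≤-Reasoning

  block-fibre-interval : ∀ {L a} → Unique (d ∷ᴸ L) → a ∈ L →
    ∃ λ lo → ∀ x → block L x ≡ a → ∃ λ (o : Fin (w a)) → x ≡ lo + toℕ o
  block-fibre-interval {y ∷ᴸ ys} ((d≢y All.∷ _) ∷ᵃ (y∉ys ∷ᵃ _)) (hereᴸ refl) = 0 , first-block
    where
    first-block : ∀ x → block (y ∷ᴸ ys) x ≡ y → ∃ λ (o : Fin (w y)) → x ≡ toℕ o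
    first-block x b≡y with x <? w y
    ... | yes x<wy = fromℕ< x<wy , sym (toℕ-fromℕ< x<wy)
    ... | no _ with subst (_∈ d ∷ᴸ ys) b≡y (block-∈ ys (x ∸ w y))
    ...   | hereᴸ y≡d = contradiction (sym y≡d) d≢y
    ...   | thereᴸ y∈ys = contradiction refl (All.lookup y∉ys y∈ys)
  block-fibre-interval {y ∷ᴸ ys} {a} ((_ All.∷ d∉ys) ∷ᵃ (y∉ys ∷ᵃ ys-unique)) (thereᴸ a∈ys)
    with lo , later-block ← block-fibre-interval (d∉ys ∷ᵃ ys-unique) a∈ys = w y + lo , shifted
    where
    shifted : ∀ x → block (y ∷ᴸ ys) x ≡ a → ∃ λ (o : Fin (w a)) → x ≡ w y + lo + toℕ o
    shifted x b≡a with x <? w y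
    ... | yes _ = contradiction b≡a (All.lookup y∉ys a∈ys)
    ... | no x≮wy with o , x∸wy≡ ← later-block (x ∸ w y) b≡a = o , (begin
      x                    ≡⟨ m+[n∸m]≡n (≮⇒≥ x≮wy) ⟨
      w y + (x ∸ w y)      ≡⟨ cong (w y +_) x∸wy≡ ⟩
      w y + (lo + toℕ o)   ≡⟨ +-assoc (w y) lo (toℕ o) ⟨
      w y + lo + toℕ o     ∎)
      where open ≡-Reasoning

module _ {n k : ℕ} where

  edge-least : (e : HEdge (Complete n (suc k))) → ∃ (Least (proj₁ e))
  edge-least (e , ∣e∣≡1+k) = least e (∣p∣>0⇒Nonempty e (subst (0 <_) (sym ∣e∣≡1+k) z<s))

  least-vertex : HEdge (Complete n (suc k)) → Fin n
  least-vertex e = proj₁ (edge-least e)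

  matching-least-vertex-≢ : ∀ {m} {M : Fin m → HEdge (Complete n (suc k))} →
    IsMatching (Complete n (suc k)) M → ∀ {i j} → i ≢ j → least-vertex (M i) ≢ least-vertex (M j)
  matching-least-vertex-≢ {M = M} disjoint {i} {j} i≢j vᵢ≡vⱼ =
    disjoint i j i≢j (least-vertex (M i) ,
      x∈p∩q⁺ (proj₁ (proj₂ (edge-least (M i))) ,
              subst (_∈ˢ proj₁ (M j)) (sym vᵢ≡vⱼ) (proj₁ (proj₂ (edge-least (M j))))))

  matching-above-size : ∀ {m} {M : Fin m → HEdge (Complete n (suc k))} →
    IsMatching (Complete n (suc k)) M → ∀ s → (∀ i → s ≤ toℕ (least-vertex (M i))) →
    m * suc k ≤ n ∸ s
  matching-above-size {m} {M} disjoint s above = begin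
    m * suc k                ≡⟨ ∣⋃ᶠ∣≡m*k (proj₁ ∘ M) disjoint (proj₂ ∘ M) ⟨
    ∣ ⋃ᶠ (proj₁ ∘ M) ∣       ≤⟨ ∣p∣≤n∸s s (⋃ᶠ (proj₁ ∘ M)) ⋃M-above ⟩
    n ∸ s                    ∎
    where
    open ≤-Reasoning
    ⋃M-above : ∀ {v} → v ∈ˢ ⋃ᶠ (proj₁ ∘ M) → s ≤ toℕ v
    ⋃M-above v∈⋃M with i , v∈Mᵢ ← ∈⋃ᶠ⁻ (proj₁ ∘ M) v∈⋃M =
      ≤-trans (above i) (proj₂ (proj₂ (edge-least (M i))) v∈Mᵢ)

module _ {n k r : ℕ} (τ : ColorFrequency r) (d : ℕ) (rest : List ℕ) (unique : Unique (d ∷ᴸ rest)) where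

  private
    w : ℕ → ℕ
    w a = toℕ (τ a)

  open Blocks w d

  least-vertex-colouring : HEdge (Complete n (suc k)) → ℕ
  least-vertex-colouring e = block rest (toℕ (least-vertex e))

  least-vertex-colouring-valid : n ∸ sum (map w rest) < suc (w d) * suc k →
    IsMatchingColoring τ (Complete n (suc k)) (d ∷ᴸ rest , unique) least-vertex-colouring
  least-vertex-colouring-valid few-left = (λ e → block-∈ rest (toℕ (least-vertex e))) , no-monochromatic
    where
    no-monochromatic : ∀ a → a ∈ d ∷ᴸ rest →
      ¬ (Σ (Fin (suc (w a)) → HEdge (Complete n (suc k))) λ M →
           IsMatching (Complete n (suc k)) M × (∀ i → least-vertex-colouring (M i) ≡ a))
    no-monochromatic a (hereᴸ refl) (M , disjoint , colour) =
      <⇒≱ few-left (matching-above-size disjoint (sum (map w rest))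
        (λ i → block≡d⇒sum≤ unique (toℕ (least-vertex (M i))) (colour i)))
    no-monochromatic a (thereᴸ a∈rest) (M , disjoint , colour)
      with lo , interval ← block-fibre-interval unique a∈rest
      with i , j , i<j , oᵢ≡oⱼ ← pigeonhole (n<1+n (w a)) (λ i → proj₁ (interval _ (colour i))) =
      matching-least-vertex-≢ disjoint (<ᶠ⇒≢ i<j) (toℕ-injective (begin
        toℕ (least-vertex (M i))                   ≡⟨ proj₂ (interval _ (colour i)) ⟩
        lo + toℕ (proj₁ (interval _ (colour i)))   ≡⟨ cong (λ o → lo + toℕ o) oᵢ≡oⱼ ⟩
        lo + toℕ (proj₁ (interval _ (colour j)))   ≡⟨ proj₂ (interval _ (colour j)) ⟨
        toℕ (least-vertex (M j))                   ∎))
      where open ≡-Reasoning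

exchange : ∀ d x xs → Unique (x ∷ᴸ xs) → ∃₂ λ y rest → x ∷ᴸ xs ↭ y ∷ᴸ rest × Unique (d ∷ᴸ rest)
exchange d x xs unique with d ∈? x ∷ᴸ xs
... | yes d∈ with ys , zs , eq ← ∈-∃++ d∈ =
  d , ys ++ zs , perm , Permₛ.Unique-resp-↭ (setoid ℕ) (↭⇒↭ₛ perm) unique
  where
  perm : x ∷ᴸ xs ↭ d ∷ᴸ ys ++ zs
  perm = ↭-trans (↭-reflexive eq) (shift d ys zs)
... | no d∉ with _ ∷ᵃ xs-unique ← unique = x , xs , ↭-refl , ¬Any⇒All¬ xs (d∉ ∘ thereᴸ) ∷ᵃ xs-unique

n∸s<[1+r][1+k] : ∀ n r k s → n ∸ suc r * k ≤ r + s → n ∸ s < suc r * suc k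
n∸s<[1+r][1+k] n r k s n∸rk≤r+s = m<n+o⇒m∸n<o n s (begin-strict
  n                            ≤⟨ m≤n+m∸n n (suc r * k) ⟩
  suc r * k + (n ∸ suc r * k)  ≤⟨ +-monoʳ-≤ (suc r * k) n∸rk≤r+s ⟩
  suc r * k + (r + s)          <⟨ n<1+n _ ⟩
  suc (suc r * k + (r + s))    ≡⟨ rearrange r k s ⟩
  s + suc r * suc k            ∎)
  where
  open ≤-Reasoning
  rearrange : ∀ r k s → suc (suc r * k + (r + s)) ≡ s + suc r * suc k
  rearrange = solve-∀

proposition2p4 : (n k r : ℕ) → 1 ≤ n → 1 ≤ k → 2 ≤ r → r * k ≤ n →
    (τ : ColorFrequency r) → (∃ λ a → toℕ (τ a) ≡ r ∸ 1) →
    (A : FinSetℕ) → n ∸ r * (k ∸ 1) ≤ sum (map (λ a → toℕ (τ a)) (proj₁ A)) →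
    χM≤ τ (Complete n k) (card A)
proposition2p4 n (suc k) (suc r) _ (s≤s z≤n) (s≤s _) rk≤n τ _ ([]ᴸ , _) n∸rk≤0 =
  contradiction rk≤n (<⇒≱ (n∸s<[1+r][1+k] n r k 0 (≤-trans n∸rk≤0 z≤n)))
proposition2p4 n (suc k) (suc r) _ (s≤s z≤n) (s≤s _) _ τ (d , τd≡r) (x ∷ᴸ xs , unique) n∸rk≤ΣA
  with y , rest , perm , unique′ ← exchange d x xs unique =
  subst (χM≤ τ (Complete n (suc k))) (sym (↭-length perm))
    ((d ∷ᴸ rest , unique′) , ≤-refl , least-vertex-colouring τ d rest unique′ ,
     least-vertex-colouring-valid τ d rest unique′ few-left)
  where
  w : ℕ → ℕ
  w a = toℕ (τ a)
  n∸rk≤r+Σrest : n ∸ suc r * k ≤ r + sum (map w rest)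
  n∸rk≤r+Σrest = begin
    n ∸ suc r * k              ≤⟨ n∸rk≤ΣA ⟩
    sum (map w (x ∷ᴸ xs))      ≡⟨ sum-↭ (↭-map⁺ w perm) ⟩
    w y + sum (map w rest)     ≤⟨ +-monoˡ-≤ (sum (map w rest)) (s≤s⁻¹ (toℕ<n (τ y))) ⟩
    r + sum (map w rest)       ∎
    where open ≤-Reasoning
  few-left : n ∸ sum (map w rest) < suc (w d) * suc k
  few-left = subst (λ t → n ∸ sum (map w rest) < suc t * suc k) (sym τd≡r)
                   (n∸s<[1+r][1+k] n r k (sum (map w rest)) n∸rk≤r+Σrest)
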